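{- For every integer $m\ge1$, every term of $Y\cdot P^m\cdot Y\in B^{\otimes(m+1)}$ contains the letter $Y$ at least once.
   Context: Let $\mathcal M=\mathbb Z\langle y,n\rangle/(yn=ny=n,\ n^2=0,\ y^2=y)$. In the ring $\mathcal M\otimes\mathcal M$ (tensor over $\mathbb Z$, with $(a\otimes b)(c\otimes d)=ac\otimes bd$) put $X=y\otimes n+n\otimes y$, $Y=y\otimes y$, $Z=n\otimes n$, and let $B$ be the $\mathbb Z$-span of $X,Y,Z$: a commutative subring, free abelian with basis $X,Y,Z$, with $X^2=2Z$, $Y^2=Y$, $Z^2=0$, $XY=YX=X$, $XZ=ZX=0$, $YZ=ZY=Z$. For $r\ge1$, $B^{\otimes r}$ is free abelian with basis the words $w_1\otimes\cdots\otimes w_r$, $w_i\in\{X,Y,Z\}$; writing $u\in B^{\otimes r}$ uniquely as $\sum_w c_w w$, a term of $u$ is a word $w$ with $c_w\ne0$, and $c_w$ is its coefficient. The chaining product $B^{\otimes r}\times B^{\otimes s}\to B^{\otimes(r+s-1)}$ is the bilinear (associative) map $(a_1\otimes\cdots\otimes a_r)\cdot(b_1\otimes\cdots\otimes b_s)=a_1\otimes\cdots\otimes a_{r-1}\otimes(a_rb_1)\otimes b_2\otimes\cdots\otimes b_s$. Elements of $B$ are regarded as elements of $B^{\otimes1}$. Let $P=X\otimes Y+Y\otimes X\in B^{\otimes2}$ and let $P^m\in B^{\otimes(m+1)}$ be its $m$-fold chaining product. -}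

module Defs where

open import Data.Nat using (ℕ; zero; suc; _+_)
open import Data.Nat.Properties using (+-suc)
open import Data.Integer using (ℤ; +_; 0ℤ) renaming (_+_ to _+ℤ_; _*_ to _*ℤ_)
open import Data.Product using (_×_; _,_)
open import Data.List using (List; []; _∷_; concatMap)
open import Data.Vec using (Vec; []; _∷_; _++_; init; last; head; tail; cast)
open import Data.Vec.Properties using (≡-dec)
open import Relation.Binary.PropositionalEquality using (_≡_; refl)
open import Relation.Nullary using (Dec; yes; no)

data Letter : Set where
  X Y Z : Letter

_≟L_ : (a b : Letter) → Dec (a ≡ b)
X ≟L X = yes refl
X ≟L Y = no λ ()
X ≟L Z = no λ ()
Y ≟L X = no λ ()
Y ≟L Y = yes refl
Y ≟L Z = no λ ()
Z ≟L X = no λ ()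
Z ≟L Y = no λ ()
Z ≟L Z = yes refl

-- Words of length r: basis elements w₁ ⊗ ⋯ ⊗ w_r of B^{⊗r}.
Word : ℕ → Set
Word r = Vec Letter r

-- An element of B^{⊗r}, given as a finite formal ℤ-linear combination of words
-- (repetitions allowed; the element is determined by its coefficients below).
Tensor : ℕ → Set
Tensor r = List (ℤ × Word r)

coeff : ∀ {r} → Tensor r → Word r → ℤ
coeff [] w = 0ℤ
coeff ((c , v) ∷ u) w with ≡-dec _≟L_ v w
... | yes _ = c +ℤ coeff u w
... | no  _ = coeff u w

mulL : Letter → Letter → List (ℤ × Letter)
mulL X X = (+ 2 , Z) ∷ []
mulL X Y = (+ 1 , X) ∷ []
mulL X Z = []
mulL Y X = (+ 1 , X) ∷ []
mulL Y Y = (+ 1 , Y) ∷ []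
mulL Y Z = (+ 1 , Z) ∷ []
mulL Z X = []
mulL Z Y = (+ 1 , Z) ∷ []
mulL Z Z = []

-- Chaining product B^{⊗(r+1)} × B^{⊗(s+1)} → B^{⊗(r+s+1)}, bilinear extension of
-- (a₁⊗⋯⊗a_{r+1})·(b₁⊗⋯⊗b_{s+1}) = a₁⊗⋯⊗a_r⊗(a_{r+1}b₁)⊗b₂⊗⋯⊗b_{s+1}.
chainWord : ∀ {r s} → Word (suc r) → Letter → Word (suc s) → Word (suc (r + s))
chainWord {r} {s} a c b = cast (+-suc r s) (init a ++ (c ∷ tail b))

chain : ∀ {r s} → Tensor (suc r) → Tensor (suc s) → Tensor (suc (r + s))
chain u v =
  concatMap (λ { (p , a) →
    concatMap (λ { (q , b) →
      Data.List.map (λ { (e , c) → ((p *ℤ q) *ℤ e , chainWord a c b) })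
                    (mulL (last a) (head b)) }) v }) u

Yt : Tensor 1
Yt = (+ 1 , Y ∷ []) ∷ []

P : Tensor 2
P = (+ 1 , X ∷ Y ∷ []) ∷ (+ 1 , Y ∷ X ∷ []) ∷ []

-- Ppow k = P^(k+1) ∈ B^{⊗(k+2)}, defined as P^(k+1) = P · P^k (chaining is associative).
Ppow : (k : ℕ) → Tensor (suc (suc k))
Ppow zero    = P
Ppow (suc k) = chain P (Ppow k)

-- Y · P^m · Y ∈ B^{⊗(m+1)} for m = k+1 (length written suc (suc k + 0)).
YPY : (k : ℕ) → Tensor (suc (suc k + 0))
YPY k = chain (chain Yt (Ppow k)) Yt

-- Words containing Y are closed under chaining: a Y of a before its last
-- position survives in a·b, and if the last letter of a is Y then, Y being
-- the unit of B, the product word is init a ⊗ b, which contains the Y of b.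
-- Y, P, hence P^m and Y·P^m·Y, list only such words, and a word that is not
-- listed has coefficient 0.
module Submission where

open import Defs
open import Data.Nat using (ℕ; zero; suc; _+_)
open import Data.Integer using (+_; 0ℤ)
open import Data.Product using (_,_; proj₂)
open import Data.Sum using (_⊎_; inj₁; inj₂; map₁)
open import Data.List using ([]; _∷_)
open import Data.List.Relation.Unary.All as All using (All; []; _∷_)
open import Data.List.Relation.Unary.All.Properties using (concat⁺; map⁺)
open import Data.List.Relation.Unary.Any using (Any; here; there)
open import Data.Vec using (Vec; []; _∷_; init; last; head; cast)
open import Data.Vec.Properties using (≡-dec)
open import Data.Vec.Membership.Propositional using (_∈_)
open import Data.Vec.Membership.Propositional.Properties using (∈-++⁺ˡ; ∈-++⁺ʳ)
import Data.Vec.Relation.Unary.Any as Vec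
open import Function using (_∘_)
open import Relation.Binary.PropositionalEquality using (_≡_; _≢_; refl; sym)
open import Relation.Nullary using (yes; no)

module _ {A : Set} where

  ∈-cast : ∀ {m n} .(eq : m ≡ n) {x : A} {xs : Vec A m} → x ∈ xs → x ∈ cast eq xs
  ∈-cast {n = suc _} eq {xs = _ ∷ _} (Vec.here x≡y)   = Vec.here x≡y
  ∈-cast {n = suc _} eq {xs = _ ∷ _} (Vec.there x∈xs) = Vec.there (∈-cast _ x∈xs)

  ∈-init⊎last : ∀ {n} {x : A} {xs : Vec A (suc n)} → x ∈ xs → x ∈ init xs ⊎ x ≡ last xs
  ∈-init⊎last {xs = _ ∷ []}    (Vec.here x≡y) = inj₂ x≡y
  ∈-init⊎last {xs = _ ∷ _ ∷ _} (Vec.here x≡y) = inj₁ (Vec.here x≡y)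
  ∈-init⊎last {xs = _ ∷ _ ∷ _} (Vec.there x∈xs) = map₁ Vec.there (∈-init⊎last x∈xs)

mulL-identityˡ : ∀ c → mulL Y c ≡ (+ 1 , c) ∷ []
mulL-identityˡ X = refl
mulL-identityˡ Y = refl
mulL-identityˡ Z = refl

∈-chainWord⁺ˡ : ∀ {r s x c} {a : Word (suc r)} {b : Word (suc s)} →
  x ∈ init a → x ∈ chainWord a c b
∈-chainWord⁺ˡ x∈init = ∈-cast _ (∈-++⁺ˡ x∈init)

∈-chainWord⁺ʳ : ∀ {r s x} {a : Word (suc r)} {b : Word (suc s)} →
  x ∈ b → x ∈ chainWord a (head b) b
∈-chainWord⁺ʳ {a = a} {b = _ ∷ _} x∈b = ∈-cast _ (∈-++⁺ʳ (init a) x∈b)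

chainWord-∋Y : ∀ {r s} {a : Word (suc r)} {b : Word (suc s)} → Y ∈ a → Y ∈ b →
  All (λ (_ , c) → Y ∈ chainWord a c b) (mulL (last a) (head b))
chainWord-∋Y {a = a} {b} Y∈a Y∈b with ∈-init⊎last Y∈a
... | inj₁ Y∈init = All.universal (λ _ → ∈-chainWord⁺ˡ {b = b} Y∈init) _
... | inj₂ Y≡last rewrite sym Y≡last | mulL-identityˡ (head b) = ∈-chainWord⁺ʳ Y∈b ∷ []

AllWords : ∀ {r} → (Word r → Set) → Tensor r → Set
AllWords Q = All (Q ∘ proj₂)

allWords-chain : ∀ {r s} {A : Word (suc r) → Set} {B : Word (suc s) → Set}
  {C : Word (suc (r + s)) → Set} {u : Tensor (suc r)} {v : Tensor (suc s)} →
  (∀ {a b} → A a → B b → All (λ (_ , c) → C (chainWord a c b)) (mulL (last a) (head b))) →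
  AllWords A u → AllWords B v → AllWords C (chain u v)
allWords-chain closed Au Bv =
  concat⁺ (map⁺ (All.map (λ Aa → concat⁺ (map⁺ (All.map (λ Bb → map⁺ (closed Aa Bb)) Bv))) Au))

coeff≢0⇒listed : ∀ {r} (u : Tensor r) w → coeff u w ≢ 0ℤ → Any ((_≡ w) ∘ proj₂) u
coeff≢0⇒listed []            w c≢0 with () ← c≢0 refl
coeff≢0⇒listed ((c , v) ∷ u) w c≢0 with ≡-dec _≟L_ v w
... | yes v≡w = here v≡w
... | no  _   = there (coeff≢0⇒listed u w c≢0)

allWords-coeff≢0 : ∀ {r} {Q : Word r → Set} {u : Tensor r} {w : Word r} →
  AllWords Q u → coeff u w ≢ 0ℤ → Q w
allWords-coeff≢0 {Q = Q} {u} {w} Qu c≢0 =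
  All.lookupWith {R = λ _ → Q w} (λ { Qv refl → Qv }) Qu (coeff≢0⇒listed u w c≢0)

allWords-∋Y-chain : ∀ {r s} {u : Tensor (suc r)} {v : Tensor (suc s)} →
  AllWords (Y ∈_) u → AllWords (Y ∈_) v → AllWords (Y ∈_) (chain u v)
allWords-∋Y-chain = allWords-chain chainWord-∋Y

Yt-allWords-∋Y : AllWords (Y ∈_) Yt
Yt-allWords-∋Y = Vec.here refl ∷ []

P-allWords-∋Y : AllWords (Y ∈_) P
P-allWords-∋Y = Vec.there (Vec.here refl) ∷ Vec.here refl ∷ []

Ppow-allWords-∋Y : ∀ k → AllWords (Y ∈_) (Ppow k)
Ppow-allWords-∋Y zero    = P-allWords-∋Y
Ppow-allWords-∋Y (suc k) = allWords-∋Y-chain P-allWords-∋Y (Ppow-allWords-∋Y k)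

lemma5p2 : (k : ℕ) → (w : Word (suc (suc k + 0))) →
    coeff (YPY k) w ≢ 0ℤ → Y ∈ w
lemma5p2 k w = allWords-coeff≢0 YPY-allWords-∋Y
  where
  YPY-allWords-∋Y : AllWords (Y ∈_) (YPY k)
  YPY-allWords-∋Y = allWords-∋Y-chain
    (allWords-∋Y-chain Yt-allWords-∋Y (Ppow-allWords-∋Y k)) Yt-allWords-∋Y
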